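{- Let $G$ and $H$ be finite, simple, connected graphs, each with at least two vertices, and let $S_1\subseteq V(G)$, $S_2\subseteq V(H)$. Then for every integer $r\ge 1$, $I^r[S_1]\times I^r[S_2]\subseteq I^r[S_1\times S_2]$, where the right-hand side is computed in $G\boxtimes H$.
   Context: In a connected graph, the closed interval $I[x,y]$ consists of $x$, $y$ and all vertices on some shortest $x$–$y$ path; for a vertex set $S$, $I[S]=\bigcup_{u,v\in S}I[u,v]$, $I^0[S]=S$ and $I^i[S]=I[I^{i-1}[S]]$ for $i\ge 1$. The strong product $G\boxtimes H$ has vertex set $V(G)\times V(H)$, with $(g,h)$ and $(g',h')$ adjacent whenever ($g=g'$ and $hh'\in E(H)$), or ($h=h'$ and $gg'\in E(G)$), or ($gg'\in E(G)$ and $hh'\in E(H)$). -}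

module Defs where

open import Data.Nat using (ℕ; zero; suc; _+_; _≤_)
open import Data.Fin using (Fin)
open import Data.Product using (Σ; ∃; ∃-syntax; _×_; _,_; proj₁; proj₂)
open import Data.Sum using (_⊎_; inj₁; inj₂)
open import Data.Empty using (⊥)
open import Relation.Nullary using (¬_)
open import Relation.Binary.PropositionalEquality using (_≡_; _≢_; refl)
open import Function.Bundles using (_↔_)

record Graph : Set₁ where
  field
    V     : Set
    Adj   : V → V → Set
    sym   : ∀ {x y} → Adj x y → Adj y x
    irref : ∀ x → ¬ Adj x x

open Graph public

VSet : Graph → Set₁
VSet G = V G → Set

Finite : Graph → Set
Finite G = Σ ℕ λ n → V G ↔ Fin n

AtLeastTwo : Graph → Set
AtLeastTwo G = Σ (V G) λ x → Σ (V G) λ y → x ≢ y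

data Walk (G : Graph) : V G → V G → ℕ → Set where
  [_]  : (x : V G) → Walk G x x zero
  _∷_  : ∀ {x y z k} → Adj G x y → Walk G y z k → Walk G x z (suc k)

data _∈W_ {G : Graph} (z : V G) : ∀ {x y k} → Walk G x y k → Set where
  here-end : z ∈W [ z ]
  here     : ∀ {y w k} (e : Adj G z y) (p : Walk G y w k) → z ∈W (e ∷ p)
  there    : ∀ {x y w k} (e : Adj G x y) {p : Walk G y w k} → z ∈W p → z ∈W (e ∷ p)

Connected : Graph → Set
Connected G = ∀ (x y : V G) → Σ ℕ λ k → Walk G x y k

-- A walk of length k from x to y is shortest if every x–y walk has length ≥ k.
-- (A shortest walk is automatically a path, i.e. a shortest path.)
IsShortest : (G : Graph) → V G → V G → ℕ → Set
IsShortest G x y k = ∀ m → Walk G x y m → k ≤ m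

Interval : (G : Graph) → V G → V G → VSet G
Interval G x y z =
  Σ ℕ λ k → Σ (Walk G x y k) λ w → IsShortest G x y k × (z ∈W w)

IntervalSet : (G : Graph) → VSet G → VSet G
IntervalSet G S z = Σ (V G) λ u → Σ (V G) λ v → S u × S v × Interval G u v z

IntervalIter : (G : Graph) → ℕ → VSet G → VSet G
IntervalIter G zero    S = S
IntervalIter G (suc i) S = IntervalSet G (IntervalIter G i S)

StrongAdj : (G H : Graph) → V G × V H → V G × V H → Set
StrongAdj G H (g , h) (g' , h') =
  (g ≡ g' × Adj H h h') ⊎ ((h ≡ h' × Adj G g g') ⊎ (Adj G g g' × Adj H h h'))

private
  sAdj-sym : (G H : Graph) → ∀ {x y} → StrongAdj G H x y → StrongAdj G H y x
  sAdj-sym G H (inj₁ (refl , a)) = inj₁ (refl , sym H a)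
  sAdj-sym G H (inj₂ (inj₁ (refl , a))) = inj₂ (inj₁ (refl , sym G a))
  sAdj-sym G H (inj₂ (inj₂ (a , b))) = inj₂ (inj₂ (sym G a , sym H b))

  sAdj-irr : (G H : Graph) → ∀ x → ¬ StrongAdj G H x x
  sAdj-irr G H (g , h) (inj₁ (_ , a)) = irref H h a
  sAdj-irr G H (g , h) (inj₂ (inj₁ (_ , a))) = irref G g a
  sAdj-irr G H (g , h) (inj₂ (inj₂ (a , _))) = irref G g a

_⊠_ : Graph → Graph → Graph
G ⊠ H = record
  { V = V G × V H
  ; Adj = StrongAdj G H
  ; sym = sAdj-sym G H
  ; irref = sAdj-irr G H
  }

_×ˢ_ : {G H : Graph} → VSet G → VSet H → VSet (G ⊠ H)
(S₁ ×ˢ S₂) (g , h) = S₁ g × S₂ h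

module Submission where

-- It suffices to prove the one-step inclusion
--   I[A] × I[B] ⊆ I[A × B]   in G ⊠ H,  for arbitrary vertex sets A, B;
-- the theorem follows by induction on r, using that I[-] is monotone.
-- Let g lie on a shortest u–v path of G (u, v ∈ A), cut at g into pieces of
-- lengths i, i₂, and h on a shortest u'–v' path of H (u', v' ∈ B), cut at h
-- into pieces of lengths j, j₂.  A counting argument shows that one factor
-- "dominates": say both i and i₂ are at least min(j, j₂).  Then h is within
-- distance i of some y ∈ B and within distance i₂ of some y' ∈ B, so the
-- G-path can be zipped with H-walks (which may stand still) into a
-- (u,y)–(v,y') walk of length i + i₂ through (g,h).  It is shortest because
-- projecting a walk of G ⊠ H to G does not increase its length.  The other
-- case is the same argument with the factors swapped, via G ⊠ H ≅ H ⊠ G.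

open import Defs
open import Data.Nat using (ℕ; zero; suc; _+_; _≤_; z≤n; s≤s)
open import Data.Nat.Properties using (+-identityʳ; +-suc; m≤n⇒m≤1+n; _≤?_; ≰⇒≥; ≤-trans)
open import Data.Product using (Σ; _×_; _,_; swap)
open import Data.Sum using (_⊎_; inj₁; inj₂)
open import Function using (_∘_)
open import Relation.Nullary using (¬_; Dec; yes; no)
open import Relation.Nullary.Decidable using (_⊎-dec_)
open import Relation.Binary.PropositionalEquality using (_≡_; refl; subst)

module _ {G : Graph} where

  _++W_ : ∀ {x y z k m} → Walk G x y k → Walk G y z m → Walk G x z (k + m)
  [ _ ] ++W w′ = w′
  (e ∷ w) ++W w′ = e ∷ (w ++W w′)

  start∈ : ∀ {x y k} (w : Walk G x y k) → x ∈W w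
  start∈ [ x ] = here-end
  start∈ (e ∷ w) = here e w

  junction∈ : ∀ {x y z k m} (w : Walk G x y k) (w′ : Walk G y z m) → y ∈W (w ++W w′)
  junction∈ [ _ ] w′ = start∈ w′
  junction∈ (e ∷ w) w′ = there e (junction∈ w w′)

  cut : ∀ {x y z k} (w : Walk G x y k) → z ∈W w →
        Σ ℕ λ p → Σ ℕ λ q → p + q ≡ k × Walk G x z p × Walk G z y q
  cut [ z ] here-end = 0 , 0 , refl , [ z ] , [ z ]
  cut {z = z} (_∷_ {k = k} e w) (here .e .w) = 0 , suc k , refl , [ z ] , e ∷ w
  cut (e ∷ w) (there .e z∈w) with cut w z∈w
  ... | p , q , refl , w₁ , w₂ = suc p , q , refl , e ∷ w₁ , w₂

  reverseOnto : ∀ {x y z m n} → Walk G y x m → Walk G y z n → Walk G z x (n + m)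
  reverseOnto acc [ _ ] = acc
  reverseOnto {x} {m = m} acc (_∷_ {z = z} {k = n} e w) =
    subst (Walk G z x) (+-suc n m) (reverseOnto (Graph.sym G e ∷ acc) w)

  reverse : ∀ {x y k} → Walk G x y k → Walk G y x k
  reverse {x} {k = k} w = subst (Walk G _ x) (+-identityʳ k) (reverseOnto [ x ] w)

  cutShortest : ∀ {u v z} → Interval G u v z →
    Σ ℕ λ i → Σ ℕ λ i₂ → IsShortest G u v (i + i₂) × Walk G u z i × Walk G z v i₂
  cutShortest (k , w , shortest , z∈w) with cut w z∈w
  ... | i , i₂ , refl , w₁ , w₂ = i , i₂ , shortest , w₁ , w₂

  joinShortest : ∀ {u v z i i₂} → IsShortest G u v (i + i₂) →
    Walk G u z i → Walk G z v i₂ → Interval G u v z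
  joinShortest {i = i} {i₂} shortest w₁ w₂ =
    i + i₂ , w₁ ++W w₂ , shortest , junction∈ w₁ w₂

  interval-mono : (S T : VSet G) → (∀ z → S z → T z) →
    ∀ z → IntervalSet G S z → IntervalSet G T z
  interval-mono S T S⊆T z (u , v , Su , Sv , z∈I) = u , v , S⊆T u Su , S⊆T v Sv , z∈I

OneWithin : ℕ → ℕ → ℕ → Set
OneWithin j j₂ n = j ≤ n ⊎ j₂ ≤ n

oneWithin? : ∀ j j₂ n → Dec (OneWithin j j₂ n)
oneWithin? j j₂ n = (j ≤? n) ⊎-dec (j₂ ≤? n)

belowBoth : ∀ {j j₂ n} → ¬ OneWithin j j₂ n → n ≤ j × n ≤ j₂
belowBoth out = ≰⇒≥ (out ∘ inj₁) , ≰⇒≥ (out ∘ inj₂)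

dominance : ∀ i i₂ j j₂ →
  (OneWithin j j₂ i × OneWithin j j₂ i₂) ⊎ (OneWithin i i₂ j × OneWithin i i₂ j₂)
dominance i i₂ j j₂ with oneWithin? j j₂ i | oneWithin? j j₂ i₂
... | yes within | yes within₂ = inj₁ (within , within₂)
... | no out | _ = let i≤j , i≤j₂ = belowBoth out in inj₂ (inj₁ i≤j , inj₁ i≤j₂)
... | yes _ | no out = let i₂≤j , i₂≤j₂ = belowBoth out in inj₂ (inj₂ i₂≤j , inj₂ i₂≤j₂)

Near : (H : Graph) → VSet H → V H → ℕ → Set
Near H B h n = Σ (V H) λ y → B y × Σ ℕ λ k → k ≤ n × Walk H h y k

near : {H : Graph} (B : VSet H) → ∀ {u′ v′ h j j₂ n} → B u′ → B v′ →
  Walk H u′ h j → Walk H h v′ j₂ → OneWithin j j₂ n → Near H B h n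
near B Bu′ Bv′ w₁ w₂ (inj₁ j≤n) = _ , Bu′ , _ , j≤n , reverse w₁
near B Bu′ Bv′ w₁ w₂ (inj₂ j₂≤n) = _ , Bv′ , _ , j₂≤n , w₂

module Product (G H : Graph) where

  zip : ∀ {x x′ y y′ n k} → Walk G x x′ n → Walk H y y′ k → k ≤ n →
        Walk (G ⊠ H) (x , y) (x′ , y′) n
  zip [ x ] [ y ] z≤n = [ (x , y) ]
  zip (e ∷ w) [ y ] z≤n = inj₂ (inj₁ (refl , e)) ∷ zip w [ y ] z≤n
  zip (e ∷ w) (a ∷ w′) (s≤s k≤n) = inj₂ (inj₂ (e , a)) ∷ zip w w′ k≤n

  project : ∀ {g h g′ h′ m} → Walk (G ⊠ H) (g , h) (g′ , h′) m →
            Σ ℕ λ k → k ≤ m × Walk G g g′ k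
  project [ _ ] = 0 , z≤n , [ _ ]
  project (_∷_ {y = _ , _} (inj₁ (refl , _)) w) with project w
  ... | k , k≤m , w′ = k , m≤n⇒m≤1+n k≤m , w′
  project (_∷_ {y = _ , _} (inj₂ (inj₁ (_ , e))) w) with project w
  ... | k , k≤m , w′ = suc k , s≤s k≤m , e ∷ w′
  project (_∷_ {y = _ , _} (inj₂ (inj₂ (e , _))) w) with project w
  ... | k , k≤m , w′ = suc k , s≤s k≤m , e ∷ w′

  shortest-lift : ∀ {u v y y′ n} → IsShortest G u v n → IsShortest (G ⊠ H) (u , y) (v , y′) n
  shortest-lift shortest m w with project w
  ... | k , k≤m , w′ = ≤-trans (shortest k w′) k≤m

  dominant : (A : VSet G) (B : VSet H) → ∀ {u v g h i i₂} → A u → A v →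
    IsShortest G u v (i + i₂) → Walk G u g i → Walk G g v i₂ →
    Near H B h i → Near H B h i₂ → IntervalSet (G ⊠ H) (_×ˢ_ {G} {H} A B) (g , h)
  dominant A B Au Av shortest w₁ w₂ (y , By , _ , k≤i , n₁) (y′ , By′ , _ , k₂≤i₂ , n₂) =
    (_ , y) , (_ , y′) , (Au , By) , (Av , By′) ,
    joinShortest (shortest-lift shortest) (zip w₁ (reverse n₁) k≤i) (zip w₂ n₂ k₂≤i₂)

module Swap (G H : Graph) where

  swapAdj : ∀ {p q} → StrongAdj G H p q → StrongAdj H G (swap p) (swap q)
  swapAdj (inj₁ (eq , a)) = inj₂ (inj₁ (eq , a))
  swapAdj (inj₂ (inj₁ (eq , a))) = inj₁ (eq , a)
  swapAdj (inj₂ (inj₂ (a , b))) = inj₂ (inj₂ (b , a))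

  swapWalk : ∀ {p q n} → Walk (G ⊠ H) p q n → Walk (H ⊠ G) (swap p) (swap q) n
  swapWalk [ p ] = [ swap p ]
  swapWalk (e ∷ w) = swapAdj e ∷ swapWalk w

  swap∈ : ∀ {z p q n} {w : Walk (G ⊠ H) p q n} → z ∈W w → swap z ∈W swapWalk w
  swap∈ here-end = here-end
  swap∈ (here e w) = here (swapAdj e) (swapWalk w)
  swap∈ (there e z∈w) = there (swapAdj e) (swap∈ z∈w)

intervalSet-swap : (G H : Graph) (A : VSet G) (B : VSet H) → ∀ {g h} →
  IntervalSet (H ⊠ G) (_×ˢ_ {H} {G} B A) (h , g) →
  IntervalSet (G ⊠ H) (_×ˢ_ {G} {H} A B) (g , h)
intervalSet-swap G H A B (p , q , Bp , Bq , k , w , shortest , z∈w) =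
  swap p , swap q , swap Bp , swap Bq ,
  k , Swap.swapWalk H G w , (λ m w′ → shortest m (Swap.swapWalk G H w′)) , Swap.swap∈ H G z∈w

interval-product : (G H : Graph) (A : VSet G) (B : VSet H) (g : V G) (h : V H) →
  IntervalSet G A g → IntervalSet H B h → IntervalSet (G ⊠ H) (_×ˢ_ {G} {H} A B) (g , h)
interval-product G H A B g h (u , v , Au , Av , g∈I) (u′ , v′ , Bu′ , Bv′ , h∈I)
  with cutShortest g∈I | cutShortest h∈I
... | i , i₂ , short , w₁ , w₂ | j , j₂ , short′ , w₁′ , w₂′ with dominance i i₂ j j₂
...   | inj₁ (within , within₂) =
  Product.dominant G H A B Au Av short w₁ w₂
    (near B Bu′ Bv′ w₁′ w₂′ within) (near B Bu′ Bv′ w₁′ w₂′ within₂)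
...   | inj₂ (within , within₂) = intervalSet-swap G H A B
  (Product.dominant H G B A Bu′ Bv′ short′ w₁′ w₂′
    (near A Au Av w₁ w₂ within) (near A Au Av w₁ w₂ within₂))

iterated-product : (G H : Graph) (S₁ : VSet G) (S₂ : VSet H) (r : ℕ) (g : V G) (h : V H) →
  IntervalIter G r S₁ g → IntervalIter H r S₂ h →
  IntervalIter (G ⊠ H) r (_×ˢ_ {G} {H} S₁ S₂) (g , h)
iterated-product G H S₁ S₂ zero g h g∈S₁ h∈S₂ = g∈S₁ , h∈S₂
iterated-product G H S₁ S₂ (suc r) g h g∈I h∈I =
  interval-mono _ _ (λ { (g′ , h′) (g′∈ , h′∈) → iterated-product G H S₁ S₂ r g′ h′ g′∈ h′∈ })
    (g , h) (interval-product G H (IntervalIter G r S₁) (IntervalIter H r S₂) g h g∈I h∈I)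

lemma5 : (G H : Graph)
    → Finite G → Connected G → AtLeastTwo G
    → Finite H → Connected H → AtLeastTwo H
    → (S₁ : VSet G) (S₂ : VSet H)
    → (r : ℕ) → 1 ≤ r
    → (g : V G) (h : V H)
    → IntervalIter G r S₁ g → IntervalIter H r S₂ h
    → IntervalIter (G ⊠ H) r (_×ˢ_ {G} {H} S₁ S₂) (g , h)
lemma5 G H _ _ _ _ _ _ S₁ S₂ r _ = iterated-product G H S₁ S₂ r
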